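{- Let $\sigma_1,\sigma_2$ be RAM memory states and let $o$ be a basic RAM operation. If $\sigma_1 \restriction \mathrm{ireg}(o) = \sigma_2 \restriction \mathrm{ireg}(o)$, then $o(\sigma_1) \restriction \mathrm{oreg}(o) = o(\sigma_2) \restriction \mathrm{oreg}(o)$.
   Context: Let $\{0,1\}^*$ denote the set of finite bit strings and $\varepsilon$ the empty bit string. A RAM memory state is a function $\sigma:\mathbb{N}\to\{0,1\}^*$ such that there exists $i\in\mathbb{N}$ with $\sigma(i+j)=\varepsilon$ for all $j\in\mathbb{N}$; let $\mathit{MS}$ be the set of all RAM memory states. For a function $o:\mathit{MS}\to\mathit{MS}$ define the output region $\mathrm{oreg}(o)=\{i\in\mathbb{N} : \exists \sigma\in\mathit{MS}\ (\sigma(i)\neq o(\sigma)(i))\}$ and the input region $\mathrm{ireg}(o)=\{i\in\mathbb{N} : \exists \sigma_1,\sigma_2\in\mathit{MS}\ (\forall j\in\mathbb{N}\setminus\{i\}\ \sigma_1(j)=\sigma_2(j)) \wedge \exists j\in\mathrm{oreg}(o)\ (o(\sigma_1)(j)\neq o(\sigma_2)(j))\}$. A basic RAM operation is a function $o:\mathit{MS}\to\mathit{MS}$ such that $\mathrm{ireg}(o)$ is finite and $|\mathrm{oreg}(o)|\le 1$. For a function $f$ and $D\subseteq\mathrm{dom}(f)$, $f\restriction D$ denotes the restriction of $f$ to $D$. -}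

module Defs where

open import Data.Bool using (Bool)
open import Data.List using (List; [])
open import Data.List.Membership.Propositional using (_∈_)
open import Data.Nat using (ℕ; _+_)
open import Data.Product using (Σ; ∃; ∃-syntax; _×_; proj₁)
open import Data.Nat using (_<_)
open import Relation.Binary.PropositionalEquality using (_≡_; _≢_)
open import Relation.Nullary using (¬_)

-- finite bit strings; ε is []
BitString : Set
BitString = List Bool

MS : Set
MS = Σ (ℕ → BitString) (λ σ → ∃[ i ] (∀ j → σ (i + j) ≡ []))

_at_ : MS → ℕ → BitString
σ at i = proj₁ σ i

oreg : (MS → MS) → ℕ → Set
oreg o i = ∃[ σ ] (σ at i ≢ o σ at i)

ireg : (MS → MS) → ℕ → Set
ireg o i = ∃[ σ₁ ] ∃[ σ₂ ]
  ((∀ j → j ≢ i → σ₁ at j ≡ σ₂ at j) ×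
   ∃[ j ] (oreg o j × (o σ₁ at j ≢ o σ₂ at j)))

FiniteSet : (ℕ → Set) → Set
FiniteSet P = ∃[ L ] (∀ i → P i → i ∈ L)

AtMostOne : (ℕ → Set) → Set
AtMostOne P = ∀ i j → P i → P j → i ≡ j

IsBasicRAMOp : (MS → MS) → Set
IsBasicRAMOp o = FiniteSet (ireg o) × AtMostOne (oreg o)

RestrEq : (ℕ → Set) → MS → MS → Set
RestrEq D σ₁ σ₂ = ∀ i → D i → σ₁ at i ≡ σ₂ at i

-- Hybrid argument. Let τₖ agree with σ₂ below k and with σ₁ from k on, so that
-- τ₀ ≈ σ₁ and τₖ ≈ σ₂ once k exceeds both states' bounds. Consecutive hybrids
-- τₖ, τₖ₊₁ differ at most at location k; if o separated them on oreg o, then k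
-- would lie in ireg o, whence σ₁ and σ₂, and so τₖ and τₖ₊₁, agree at k as well.
-- Since o need not respect pointwise equality of states, that last step uses the
-- finiteness of ireg o: two pointwise equal states separated by o would put
-- every location into ireg o.
module Submission where

open import Defs
open import Data.Bool.Properties using () renaming (_≟_ to _≟ᵇ_)
open import Data.Empty using (⊥-elim)
open import Data.List using ([])
open import Data.List.Extrema.Nat using (max; xs≤max)
open import Data.List.Properties using (≡-dec)
open import Data.List.Relation.Unary.All using (lookup)
open import Data.Nat using (ℕ; zero; suc; _+_; _∸_; _⊔_; _≤_; _<?_; _≟_)
open import Data.Nat.Properties
  using (1+n≰n; m≤m+n; m≤m⊔n; m≤n⊔m; m+[n∸m]≡n; ≤-trans; ≮⇒≥; m<n⇒m<1+n; ≤-antisym; ≤-pred; n<1+n; <-irrefl)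
open import Data.Product using (_,_; proj₁; proj₂)
open import Relation.Binary.PropositionalEquality using (_≡_; _≢_; refl; sym; trans; cong)
open import Relation.Nullary using (¬_; Dec; yes; no)

infix 4 _≟ₛ_ _≈_

_≟ₛ_ : (x y : BitString) → Dec (x ≡ y)
_≟ₛ_ = ≡-dec _≟ᵇ_

_≈_ : MS → MS → Set
σ ≈ τ = ∀ i → σ at i ≡ τ at i

AgreeOff : ℕ → MS → MS → Set
AgreeOff i σ τ = ∀ j → j ≢ i → σ at j ≡ τ at j

¬FiniteSet-everywhere : {P : ℕ → Set} → (∀ i → P i) → ¬ FiniteSet P
¬FiniteSet-everywhere all (L , P⊆L) =
  1+n≰n (lookup (xs≤max 0 L) (P⊆L (suc (max 0 L)) (all _)))

≈⇒oreg-agree : (o : MS → MS) → FiniteSet (ireg o) →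
  ∀ {σ τ} → σ ≈ τ → RestrEq (oreg o) (o σ) (o τ)
≈⇒oreg-agree o fin {σ} {τ} σ≈τ j oj with o σ at j ≟ₛ o τ at j
... | yes eq = eq
... | no neq = ⊥-elim (¬FiniteSet-everywhere everywhere-input fin)
  where
  everywhere-input : ∀ i → ireg o i
  everywhere-input i = σ , τ , (λ k _ → σ≈τ k) , j , oj , neq

AgreeOff⇒oreg-agree : (o : MS → MS) → FiniteSet (ireg o) → ∀ {i σ τ} →
  AgreeOff i σ τ → (ireg o i → σ at i ≡ τ at i) → RestrEq (oreg o) (o σ) (o τ)
AgreeOff⇒oreg-agree o fin {i} {σ} {τ} off ireg⇒agree j oj with o σ at j ≟ₛ o τ at j
... | yes eq = eq
... | no neq = ⊥-elim (neq (≈⇒oreg-agree o fin σ≈τ j oj))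
  where
  σ≈τ : σ ≈ τ
  σ≈τ k with k ≟ i
  ... | yes refl = ireg⇒agree (σ , τ , off , j , oj , neq)
  ... | no k≢i = off k k≢i

bound : MS → ℕ
bound σ = proj₁ (proj₂ σ)

at-beyond-bound : (σ : MS) → ∀ {n} → bound σ ≤ n → σ at n ≡ []
at-beyond-bound σ {n} le =
  trans (cong (proj₁ σ) (sym (m+[n∸m]≡n le))) (proj₂ (proj₂ σ) (n ∸ bound σ))

module Splice (σ₁ σ₂ : MS) where

  spliceAt : ℕ → ℕ → BitString
  spliceAt k n with n <? k
  ... | yes _ = σ₂ at n
  ... | no _ = σ₁ at n

  B : ℕ
  B = bound σ₁ ⊔ bound σ₂

  spliceAt-beyond : ∀ k n → B ≤ n → spliceAt k n ≡ []
  spliceAt-beyond k n B≤n with n <? k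
  ... | yes _ = at-beyond-bound σ₂ (≤-trans (m≤n⊔m (bound σ₁) (bound σ₂)) B≤n)
  ... | no _ = at-beyond-bound σ₁ (≤-trans (m≤m⊔n (bound σ₁) (bound σ₂)) B≤n)

  splice : ℕ → MS
  splice k = spliceAt k , B , λ j → spliceAt-beyond k (B + j) (m≤m+n B j)

  splice-zero : splice 0 ≈ σ₁
  splice-zero n with n <? 0
  ... | no _ = refl

  splice-B : splice B ≈ σ₂
  splice-B n with n <? B
  ... | yes _ = refl
  ... | no n≮B = trans (at-beyond-bound σ₁ (≤-trans (m≤m⊔n _ _) (≮⇒≥ n≮B)))
                   (sym (at-beyond-bound σ₂ (≤-trans (m≤n⊔m _ _) (≮⇒≥ n≮B))))

  splice-suc-AgreeOff : ∀ k → AgreeOff k (splice k) (splice (suc k))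
  splice-suc-AgreeOff k n n≢k with n <? k | n <? suc k
  ... | yes _ | yes _ = refl
  ... | no _ | no _ = refl
  ... | yes n<k | no n≮1+k = ⊥-elim (n≮1+k (m<n⇒m<1+n n<k))
  ... | no n≮k | yes n<1+k = ⊥-elim (n≢k (≤-antisym (≤-pred n<1+k) (≮⇒≥ n≮k)))

  splice-suc-agree-at : ∀ k → σ₁ at k ≡ σ₂ at k → splice k at k ≡ splice (suc k) at k
  splice-suc-agree-at k eq with k <? k | k <? suc k
  ... | yes k<k | _ = ⊥-elim (<-irrefl refl k<k)
  ... | no _ | no k≮1+k = ⊥-elim (k≮1+k (n<1+n k))
  ... | no _ | yes _ = eq

open Splice

theorem5 : (σ₁ σ₂ : MS) (o : MS → MS) → IsBasicRAMOp o →
    RestrEq (ireg o) σ₁ σ₂ → RestrEq (oreg o) (o σ₁) (o σ₂)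
theorem5 σ₁ σ₂ o (fin , _) agree j oj =
  trans (hybrid (B σ₁ σ₂)) (≈⇒oreg-agree o fin (splice-B σ₁ σ₂) j oj)
  where
  hybrid : ∀ k → o σ₁ at j ≡ o (splice σ₁ σ₂ k) at j
  hybrid zero = ≈⇒oreg-agree o fin (λ n → sym (splice-zero σ₁ σ₂ n)) j oj
  hybrid (suc k) = trans (hybrid k)
    (AgreeOff⇒oreg-agree o fin (splice-suc-AgreeOff σ₁ σ₂ k)
      (λ k∈ireg → splice-suc-agree-at σ₁ σ₂ k (agree k k∈ireg)) j oj)
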